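{- Let $S_1,\dots,S_n\subseteq\mathbb{Z}$ and let $f:S_1\times\cdots\times S_n\to\mathbb{Z}$ be order-preserving. If $G_i\in\mathcal{I}$ is $S_i$-valued for each $i$, then $\tilde f(G_1,\dots,G_n)\in\mathcal{I}$.
   Context: A well-tempered scoring game is defined recursively: an even-tempered game is either an integer or a pair $\{G^L|G^R\}$ with finite nonempty sets of odd-tempered left and right options; an odd-tempered game is a pair $\{G^L|G^R\}$ with finite nonempty sets of even-tempered options. Integers have no options. $\pi(G)=0$ for even-tempered, $1$ for odd-tempered games. Subgames: $G$ and subgames of its options; $G$ is $S$-valued if every integer subgame lies in $S$. Outcomes: $\operatorname{L}(n)=\operatorname{R}(n)=n$ for integers, otherwise $\operatorname{L}(G)=\max_{G^L}\operatorname{R}(G^L)$, $\operatorname{R}(G)=\min_{G^R}\operatorname{L}(G^R)$. $\operatorname{gap}_0(G)$ is the supremum of $\operatorname{R}(K)-\operatorname{L}(K)$ over even-tempered subgames $K$ of $G$; $\mathcal{I}$ is the class of games with $\operatorname{gap}_0(G)=0$. $f$ is order-preserving if $f(x_1',\dots,x_n')\ge f(x_1,\dots,x_n)$ whenever $x_i'\ge x_i$ for all $i$. The extension $\tilde f$ of $f$ to games is defined recursively: if all $G_i$ are integers, $\tilde f(G_1,\dots,G_n)=f(G_1,\dots,G_n)$; otherwise its left options are the games $\tilde f(G_1,\dots,G_{k-1},G_k^L,G_{k+1},\dots,G_n)$ and its right options the games $\tilde f(G_1,\dots,G_k^R,\dots,G_n)$, over all $k$ and all left (resp. right) options of $G_k$.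 -}

module Defs where

open import Data.Nat using (ℕ; zero; suc) renaming (_+_ to _+ℕ_; _⊔_ to _⊔ℕ_)
open import Data.Integer using (ℤ; _⊔_; _⊓_; _-_; _≤_) renaming (0ℤ to 0ℤ)
open import Data.Fin using (Fin; _≟_)
open import Data.List using (List; []; _∷_; concatMap; map; allFin)
open import Data.List.Relation.Unary.All using (All)
open import Data.Maybe using (Maybe; just; nothing)
open import Data.Product using (Σ; _×_)
open import Relation.Nullary using (yes; no)
open import Relation.Binary.PropositionalEquality using (_≡_; _≢_)

-- Raw scoring games: an integer, or a pair of lists of left / right options.
-- Well-temperedness (parity structure, nonempty option sets) is the
-- separate predicate WT below.

data Game : Set where
  int  : ℤ → Game
  node : List Game → List Game → Game

data Tempo : Set where
  even odd : Tempo

flipT : Tempo → Tempo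
flipT even = odd
flipT odd  = even

data WT : Tempo → Game → Set where
  int  : ∀ {n} → WT even (int n)
  node : ∀ {p Ls Rs} → Ls ≢ [] → Rs ≢ [] →
         All (WT (flipT p)) Ls → All (WT (flipT p)) Rs → WT p (node Ls Rs)

-- Outcomes L(G), R(G).  (Values on empty option lists are irrelevant:
-- they never occur for well-tempered games.)

mutual
  Lo : Game → ℤ
  Lo (int n) = n
  Lo (node [] Rs) = 0ℤ
  Lo (node (G ∷ Ls) Rs) = maxRo (Ro G) Ls

  Ro : Game → ℤ
  Ro (int n) = n
  Ro (node Ls []) = 0ℤ
  Ro (node Ls (G ∷ Rs)) = minLo (Lo G) Rs

  maxRo : ℤ → List Game → ℤ
  maxRo acc [] = acc
  maxRo acc (G ∷ Gs) = maxRo (acc ⊔ Ro G) Gs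

  minLo : ℤ → List Game → ℤ
  minLo acc [] = acc
  minLo acc (G ∷ Gs) = minLo (acc ⊓ Lo G) Gs

-- gap₀ p G : for G well-tempered of temper p, the maximum of R(K) - L(K)
-- over all even-tempered subgames K of G (G itself and subgames of options).

mutual
  gap0 : Tempo → Game → ℤ
  gap0 even (int n) = Ro (int n) - Lo (int n)
  gap0 odd  (int n) = 0ℤ   -- junk: not well-tempered
  gap0 even (node Ls Rs) =
    gapAcc (gapAcc (Ro (node Ls Rs) - Lo (node Ls Rs)) odd Ls) odd Rs
  gap0 odd (node [] Rs) = 0ℤ   -- junk: not well-tempered
  gap0 odd (node (G ∷ Ls) Rs) = gapAcc (gapAcc (gap0 even G) even Ls) even Rs

  gapAcc : ℤ → Tempo → List Game → ℤ
  gapAcc acc q [] = acc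
  gapAcc acc q (G ∷ Gs) = gapAcc (acc ⊔ gap0 q G) q Gs

InI : Game → Set
InI G = Σ Tempo (λ p → WT p G × gap0 p G ≡ 0ℤ)

data Valued (S : ℤ → Set) : Game → Set where
  int  : ∀ {n} → S n → Valued S (int n)
  node : ∀ {Ls Rs} → All (Valued S) Ls → All (Valued S) Rs → Valued S (node Ls Rs)

-- f : S₁ × ⋯ × Sₙ → ℤ is represented by a total f : (Fin n → ℤ) → ℤ whose
-- values outside the domain are irrelevant; order-preserving on the domain.

OrderPreserving : (n : ℕ) → (S : Fin n → ℤ → Set) → ((Fin n → ℤ) → ℤ) → Set
OrderPreserving n S f =
  ∀ (x x' : Fin n → ℤ) → (∀ i → S i (x i)) → (∀ i → S i (x' i)) →
  (∀ i → x i ≤ x' i) → f x ≤ f x'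

leftOpts : Game → List Game
leftOpts (int _) = []
leftOpts (node Ls _) = Ls

rightOpts : Game → List Game
rightOpts (int _) = []
rightOpts (node _ Rs) = Rs

update : ∀ {n} → (Fin n → Game) → Fin n → Game → (Fin n → Game)
update Gs k G i with i ≟ k
... | yes _ = G
... | no  _ = Gs i

allInts : ∀ {n} → (Fin n → Game) → Maybe (Fin n → ℤ)
allInts {zero} Gs = just (λ ())
allInts {suc n} Gs with Gs Fin.zero | allInts {n} (λ i → Gs (Fin.suc i))
... | int m | just xs = just λ { Fin.zero → m ; (Fin.suc i) → xs i }
... | int m | nothing = nothing
... | node _ _ | _ = nothing

height : Game → ℕ
heightL : List Game → ℕ
height (int _) = 0
height (node Ls Rs) = suc (heightL Ls ⊔ℕ heightL Rs)
heightL [] = 0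
heightL (G ∷ Gs) = height G ⊔ℕ heightL Gs

sumFin : ∀ {n} → (Fin n → ℕ) → ℕ
sumFin {zero} h = 0
sumFin {suc n} h = h Fin.zero +ℕ sumFin (λ i → h (Fin.suc i))

-- fuel-bounded extension; the fuel below (1 + sum of heights) is always
-- sufficient, so the fuel-exhausted junk case is never reached.
extFuel : ∀ {n} → ℕ → ((Fin n → ℤ) → ℤ) → (Fin n → Game) → Game
extFuel zero f Gs = int 0ℤ
extFuel {n} (suc k) f Gs with allInts Gs
... | just xs = int (f xs)
... | nothing =
  node (concatMap (λ i → map (λ GL → extFuel k f (update Gs i GL)) (leftOpts (Gs i))) (allFin n))
       (concatMap (λ i → map (λ GR → extFuel k f (update Gs i GR)) (rightOpts (Gs i))) (allFin n))

ext : ∀ {n} → ((Fin n → ℤ) → ℤ) → (Fin n → Game) → Game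
ext f Gs = extFuel (suc (sumFin (λ i → height (Gs i)))) f Gs

-- Every subgame of f̃(G₁,…,Gₙ) is an extension f̃(H₁,…,Hₙ) with Hᵢ a subgame of Gᵢ, so it suffices
-- to show R(f̃ Gs) ≤ L(f̃ Gs) whenever the tempers of the Gᵢ add up to even. Pick a non-integer
-- coordinate Gₖ and let Hs be Gs with Gₖ replaced by the integer c = R(Gₖ) ∈ Sₖ; then
-- R(f̃ Gs) ≤ L(f̃ Hs) ≤ L(f̃ Gs). Both inequalities reduce to four comparisons, proved by simultaneous
-- induction on the total height: replacing Gₖ by an integer c ≤ R(Gₖ) can only lower L (even total
-- parity) or R (odd total parity) of the extension, and replacing it by c ≥ L(Gₖ) can only raise them.
-- A move in another coordinate is mirrored in the other tuple; a move in Gₖ is compared with c through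
-- R(Gₖ) ≤ L(Gₖ), available because Gₖ is even-tempered at that point; integer tuples are compared by
-- the monotonicity of f.

module Submission where

open import Defs
open import Data.Nat using (ℕ; zero; suc; s≤s; z≤n) renaming (_≤_ to _≤ℕ_; _<_ to _<ℕ_)
import Data.Nat.Properties as ℕ
open import Data.Integer using (ℤ; 0ℤ; _⊔_; _⊓_; _-_; _≤_)
open import Data.Integer.Properties
  using (≤-refl; ≤-trans; ≤-antisym; ≤-reflexive; i≤i⊔j; i≤j⊔i; ⊔-lub; i⊓j≤i; i⊓j≤j; ⊔-sel; ⊓-sel;
         i≤j⇒i-j≤0; i-j≤0⇒i≤j; +-inverseʳ; module ≤-Reasoning)
open import Data.Fin using (Fin; zero; suc; _≟_)
open import Data.Fin.Properties using (suc-injective)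
open import Data.List using (List; []; _∷_; concatMap; map; allFin)
open import Data.List.Properties using (map-cong-local; concatMap-cong)
open import Data.List.Relation.Unary.All as All using (All; []; _∷_)
open import Data.List.Relation.Unary.Any as Any using (here; there)
open import Data.List.Membership.Propositional using (_∈_)
open import Data.List.Membership.Propositional.Properties
  using (∈-map⁺; ∈-map⁻; ∈-concatMap⁺; ∈-concatMap⁻; ∈-allFin)
open import Data.Maybe using (just; nothing)
open import Data.Product using (∃; _×_; _,_; proj₁; proj₂)
open import Data.Sum using (_⊎_; inj₁; inj₂)
open import Data.Empty using (⊥-elim)
open import Function using (_∘_)
open import Relation.Nullary using (yes; no)
open import Relation.Binary.PropositionalEquality
  using (_≡_; _≢_; refl; sym; trans; cong; cong₂; subst; subst₂)

-- Outcomes and the class 𝓘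

acc≤maxRo : ∀ acc Gs → acc ≤ maxRo acc Gs
acc≤maxRo acc []       = ≤-refl
acc≤maxRo acc (G ∷ Gs) = ≤-trans (i≤i⊔j acc (Ro G)) (acc≤maxRo (acc ⊔ Ro G) Gs)

Ro≤maxRo : ∀ {X} acc Gs → X ∈ Gs → Ro X ≤ maxRo acc Gs
Ro≤maxRo acc (G ∷ Gs) (here refl) = ≤-trans (i≤j⊔i acc (Ro G)) (acc≤maxRo (acc ⊔ Ro G) Gs)
Ro≤maxRo acc (G ∷ Gs) (there X∈Gs) = Ro≤maxRo (acc ⊔ Ro G) Gs X∈Gs

maxRo-attained : ∀ acc Gs → maxRo acc Gs ≡ acc ⊎ ∃ λ X → X ∈ Gs × maxRo acc Gs ≡ Ro X
maxRo-attained acc [] = inj₁ refl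
maxRo-attained acc (G ∷ Gs) with maxRo-attained (acc ⊔ Ro G) Gs | ⊔-sel acc (Ro G)
... | inj₂ (X , X∈Gs , eq) | _       = inj₂ (X , there X∈Gs , eq)
... | inj₁ eq              | inj₁ eq′ = inj₁ (trans eq eq′)
... | inj₁ eq              | inj₂ eq′ = inj₂ (G , here refl , trans eq eq′)

minLo≤acc : ∀ acc Gs → minLo acc Gs ≤ acc
minLo≤acc acc []       = ≤-refl
minLo≤acc acc (G ∷ Gs) = ≤-trans (minLo≤acc (acc ⊓ Lo G) Gs) (i⊓j≤i acc (Lo G))

minLo≤Lo : ∀ {X} acc Gs → X ∈ Gs → minLo acc Gs ≤ Lo X
minLo≤Lo acc (G ∷ Gs) (here refl) = ≤-trans (minLo≤acc (acc ⊓ Lo G) Gs) (i⊓j≤j acc (Lo G))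
minLo≤Lo acc (G ∷ Gs) (there X∈Gs) = minLo≤Lo (acc ⊓ Lo G) Gs X∈Gs

minLo-attained : ∀ acc Gs → minLo acc Gs ≡ acc ⊎ ∃ λ X → X ∈ Gs × minLo acc Gs ≡ Lo X
minLo-attained acc [] = inj₁ refl
minLo-attained acc (G ∷ Gs) with minLo-attained (acc ⊓ Lo G) Gs | ⊓-sel acc (Lo G)
... | inj₂ (X , X∈Gs , eq) | _       = inj₂ (X , there X∈Gs , eq)
... | inj₁ eq              | inj₁ eq′ = inj₁ (trans eq eq′)
... | inj₁ eq              | inj₂ eq′ = inj₂ (G , here refl , trans eq eq′)

Ro-leftOption≤Lo : ∀ {G X} → X ∈ leftOpts G → Ro X ≤ Lo G
Ro-leftOption≤Lo {node (G ∷ Ls) Rs} (here refl)  = acc≤maxRo (Ro G) Ls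
Ro-leftOption≤Lo {node (G ∷ Ls) Rs} (there X∈Ls) = Ro≤maxRo (Ro G) Ls X∈Ls

Ro≤Lo-rightOption : ∀ {G X} → X ∈ rightOpts G → Ro G ≤ Lo X
Ro≤Lo-rightOption {node Ls (G ∷ Rs)} (here refl)  = minLo≤acc (Lo G) Rs
Ro≤Lo-rightOption {node Ls (G ∷ Rs)} (there X∈Rs) = minLo≤Lo (Lo G) Rs X∈Rs

Lo-attained : ∀ {Ls Rs} → Ls ≢ [] → ∃ λ X → X ∈ Ls × Lo (node Ls Rs) ≡ Ro X
Lo-attained {[]}     Ls≢[] = ⊥-elim (Ls≢[] refl)
Lo-attained {G ∷ Ls} _ with maxRo-attained (Ro G) Ls
... | inj₁ eq = G , here refl , eq
... | inj₂ (X , X∈Ls , eq) = X , there X∈Ls , eq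

Ro-attained : ∀ {Ls Rs} → Rs ≢ [] → ∃ λ X → X ∈ Rs × Ro (node Ls Rs) ≡ Lo X
Ro-attained {Rs = []}     Rs≢[] = ⊥-elim (Rs≢[] refl)
Ro-attained {Rs = G ∷ Rs} _ with minLo-attained (Lo G) Rs
... | inj₁ eq = G , here refl , eq
... | inj₂ (X , X∈Rs , eq) = X , there X∈Rs , eq

mutual
  Lo-valued : ∀ {P p G} → WT p G → Valued P G → P (Lo G)
  Lo-valued int (int x) = x
  Lo-valued {P} (node Ls≢[] _ wLs _) (node vLs _) with Lo-attained Ls≢[]
  ... | X , X∈Ls , eq = subst P (sym eq) (All.lookup (Ro-valuedᴬ wLs vLs) X∈Ls)

  Ro-valued : ∀ {P p G} → WT p G → Valued P G → P (Ro G)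
  Ro-valued int (int x) = x
  Ro-valued {P} (node _ Rs≢[] _ wRs) (node _ vRs) with Ro-attained Rs≢[]
  ... | X , X∈Rs , eq = subst P (sym eq) (All.lookup (Lo-valuedᴬ wRs vRs) X∈Rs)

  Ro-valuedᴬ : ∀ {P q Gs} → All (WT q) Gs → All (Valued P) Gs → All (λ G → P (Ro G)) Gs
  Ro-valuedᴬ []       []       = []
  Ro-valuedᴬ (w ∷ ws) (v ∷ vs) = Ro-valued w v ∷ Ro-valuedᴬ ws vs

  Lo-valuedᴬ : ∀ {P q Gs} → All (WT q) Gs → All (Valued P) Gs → All (λ G → P (Lo G)) Gs
  Lo-valuedᴬ []       []       = []
  Lo-valuedᴬ (w ∷ ws) (v ∷ vs) = Lo-valued w v ∷ Lo-valuedᴬ ws vs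

data 𝓘 : Tempo → Game → Set where
  int  : ∀ {x} → 𝓘 even (int x)
  node : ∀ {p Ls Rs} → Ls ≢ [] → Rs ≢ [] →
         All (𝓘 (flipT p)) Ls → All (𝓘 (flipT p)) Rs →
         (p ≡ even → Ro (node Ls Rs) ≤ Lo (node Ls Rs)) → 𝓘 p (node Ls Rs)

acc≤gapAcc : ∀ acc q Gs → acc ≤ gapAcc acc q Gs
acc≤gapAcc acc q []       = ≤-refl
acc≤gapAcc acc q (G ∷ Gs) = ≤-trans (i≤i⊔j acc _) (acc≤gapAcc _ q Gs)

gap0≤gapAcc : ∀ {X} acc q Gs → X ∈ Gs → gap0 q X ≤ gapAcc acc q Gs
gap0≤gapAcc acc q (G ∷ Gs) (here refl)  = ≤-trans (i≤j⊔i acc _) (acc≤gapAcc _ q Gs)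
gap0≤gapAcc acc q (G ∷ Gs) (there X∈Gs) = gap0≤gapAcc _ q Gs X∈Gs

gapAcc-lub : ∀ {acc b} q Gs → acc ≤ b → All (λ X → gap0 q X ≤ b) Gs → gapAcc acc q Gs ≤ b
gapAcc-lub q []       acc≤b []       = acc≤b
gapAcc-lub q (G ∷ Gs) acc≤b (g ∷ gs) = gapAcc-lub q Gs (⊔-lub acc≤b g) gs

gap0-nonneg : ∀ {p G} → WT p G → 0ℤ ≤ gap0 p G
gap0-nonneg {even} (int {x}) = ≤-reflexive (sym (+-inverseʳ x))
gap0-nonneg {even} {node (G ∷ Ls) Rs} (node _ _ (w ∷ _) _) =
  ≤-trans (gap0-nonneg w) (≤-trans (gap0≤gapAcc _ odd (G ∷ Ls) (here refl)) (acc≤gapAcc _ odd Rs))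
gap0-nonneg {odd}  {node (G ∷ Ls) Rs} (node _ _ (w ∷ _) _) =
  ≤-trans (gap0-nonneg w) (≤-trans (acc≤gapAcc _ even Ls) (acc≤gapAcc _ even Rs))
gap0-nonneg {_}    {node [] Rs} (node Ls≢[] _ _ _) = ⊥-elim (Ls≢[] refl)

mutual
  𝓘⇒gap0≤0 : ∀ {p G} → 𝓘 p G → gap0 p G ≤ 0ℤ
  𝓘⇒gap0≤0 (int {x}) = ≤-reflexive (+-inverseʳ x)
  𝓘⇒gap0≤0 {even} (node _ _ iLs iRs R≤L) =
    gapAcc-lub odd _ (gapAcc-lub odd _ (i≤j⇒i-j≤0 (R≤L refl)) (𝓘⇒gap0≤0ᴬ iLs)) (𝓘⇒gap0≤0ᴬ iRs)
  𝓘⇒gap0≤0 {odd} (node _ _ (iL ∷ iLs) iRs _) =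
    gapAcc-lub even _ (gapAcc-lub even _ (𝓘⇒gap0≤0 iL) (𝓘⇒gap0≤0ᴬ iLs)) (𝓘⇒gap0≤0ᴬ iRs)
  𝓘⇒gap0≤0 {odd} (node Ls≢[] _ [] _ _) = ⊥-elim (Ls≢[] refl)

  𝓘⇒gap0≤0ᴬ : ∀ {q Gs} → All (𝓘 q) Gs → All (λ X → gap0 q X ≤ 0ℤ) Gs
  𝓘⇒gap0≤0ᴬ []       = []
  𝓘⇒gap0≤0ᴬ (i ∷ is) = 𝓘⇒gap0≤0 i ∷ 𝓘⇒gap0≤0ᴬ is

mutual
  𝓘⇒WT : ∀ {p G} → 𝓘 p G → WT p G
  𝓘⇒WT int = int
  𝓘⇒WT (node Ls≢[] Rs≢[] iLs iRs _) = node Ls≢[] Rs≢[] (𝓘⇒WTᴬ iLs) (𝓘⇒WTᴬ iRs)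

  𝓘⇒WTᴬ : ∀ {q Gs} → All (𝓘 q) Gs → All (WT q) Gs
  𝓘⇒WTᴬ []       = []
  𝓘⇒WTᴬ (i ∷ is) = 𝓘⇒WT i ∷ 𝓘⇒WTᴬ is

mutual
  gap0≤0⇒𝓘 : ∀ {p G} → WT p G → gap0 p G ≤ 0ℤ → 𝓘 p G
  gap0≤0⇒𝓘 int _ = int
  gap0≤0⇒𝓘 {even} {node Ls Rs} (node Ls≢[] Rs≢[] wLs wRs) gap≤0 =
    node Ls≢[] Rs≢[]
      (gap0≤0⇒𝓘ᴬ wLs λ X∈Ls → ≤-trans (≤-trans (gap0≤gapAcc d odd Ls X∈Ls) (acc≤gapAcc _ odd Rs)) gap≤0)
      (gap0≤0⇒𝓘ᴬ wRs λ X∈Rs → ≤-trans (gap0≤gapAcc (gapAcc d odd Ls) odd Rs X∈Rs) gap≤0)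
      (λ _ → i-j≤0⇒i≤j (≤-trans (≤-trans (acc≤gapAcc d odd Ls) (acc≤gapAcc _ odd Rs)) gap≤0))
    where d = Ro (node Ls Rs) - Lo (node Ls Rs)
  gap0≤0⇒𝓘 {odd} {node (G ∷ Ls) Rs} (node Ls≢[] Rs≢[] (w ∷ wLs) wRs) gap≤0 =
    node Ls≢[] Rs≢[]
      (gap0≤0⇒𝓘 w (≤-trans (≤-trans (acc≤gapAcc d even Ls) (acc≤gapAcc _ even Rs)) gap≤0)
        ∷ gap0≤0⇒𝓘ᴬ wLs λ X∈Ls → ≤-trans (≤-trans (gap0≤gapAcc d even Ls X∈Ls) (acc≤gapAcc _ even Rs)) gap≤0)
      (gap0≤0⇒𝓘ᴬ wRs λ X∈Rs → ≤-trans (gap0≤gapAcc (gapAcc d even Ls) even Rs X∈Rs) gap≤0)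
      (λ ())
    where d = gap0 even G
  gap0≤0⇒𝓘 {odd} {node [] Rs} (node Ls≢[] _ _ _) _ = ⊥-elim (Ls≢[] refl)

  gap0≤0⇒𝓘ᴬ : ∀ {q Gs} → All (WT q) Gs → (∀ {X} → X ∈ Gs → gap0 q X ≤ 0ℤ) → All (𝓘 q) Gs
  gap0≤0⇒𝓘ᴬ []       _     = []
  gap0≤0⇒𝓘ᴬ (w ∷ ws) gap≤0 = gap0≤0⇒𝓘 w (gap≤0 (here refl)) ∷ gap0≤0⇒𝓘ᴬ ws (gap≤0 ∘ there)

InI⇒𝓘 : ∀ {G} → InI G → ∃ λ p → 𝓘 p G
InI⇒𝓘 (p , w , gap≡0) = p , gap0≤0⇒𝓘 w (≤-reflexive gap≡0)

𝓘⇒InI : ∀ {p G} → 𝓘 p G → InI G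
𝓘⇒InI {p} i = p , 𝓘⇒WT i , ≤-antisym (𝓘⇒gap0≤0 i) (gap0-nonneg (𝓘⇒WT i))

-- Tempers, options and heights

-- Read off the game itself, so that tuples need not carry their tempers; the node [] _ clause is junk.
temper : Game → Tempo
temper (int _)          = even
temper (node [] _)      = even
temper (node (G ∷ _) _) = flipT (temper G)

flipT-involutive : ∀ p → flipT (flipT p) ≡ p
flipT-involutive even = refl
flipT-involutive odd  = refl

𝓘-temper : ∀ {p G} → 𝓘 p G → p ≡ temper G
𝓘-temper int = refl
𝓘-temper {p} (node _ _ (iL ∷ _) _ _) = trans (sym (flipT-involutive p)) (cong flipT (𝓘-temper iL))
𝓘-temper (node Ls≢[] _ [] _ _) = ⊥-elim (Ls≢[] refl)

𝓘ₜ : Game → Set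
𝓘ₜ G = 𝓘 (temper G) G

𝓘⇒𝓘ₜ : ∀ {p G} → 𝓘 p G → 𝓘ₜ G
𝓘⇒𝓘ₜ {G = G} i = subst (λ q → 𝓘 q G) (𝓘-temper i) i

option-𝓘ₜ : ∀ {p X Xs} → All (𝓘 (flipT p)) Xs → X ∈ Xs → 𝓘ₜ X × temper X ≡ flipT p
option-𝓘ₜ is X∈Xs = 𝓘⇒𝓘ₜ i , sym (𝓘-temper i)
  where i = All.lookup is X∈Xs

leftOption-𝓘ₜ : ∀ {G X} → 𝓘ₜ G → X ∈ leftOpts G → 𝓘ₜ X × temper X ≡ flipT (temper G)
leftOption-𝓘ₜ (node _ _ iLs _ _) = option-𝓘ₜ iLs

rightOption-𝓘ₜ : ∀ {G X} → 𝓘ₜ G → X ∈ rightOpts G → 𝓘ₜ X × temper X ≡ flipT (temper G)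
rightOption-𝓘ₜ (node _ _ _ iRs _) = option-𝓘ₜ iRs

𝓘ₜ-even⇒Ro≤Lo : ∀ {G} → 𝓘ₜ G → temper G ≡ even → Ro G ≤ Lo G
𝓘ₜ-even⇒Ro≤Lo int _ = ≤-refl
𝓘ₜ-even⇒Ro≤Lo (node _ _ _ _ R≤L) = R≤L

leftOption-valued : ∀ {S G X} → Valued S G → X ∈ leftOpts G → Valued S X
leftOption-valued (node vLs _) = All.lookup vLs

rightOption-valued : ∀ {S G X} → Valued S G → X ∈ rightOpts G → Valued S X
rightOption-valued (node _ vRs) = All.lookup vRs

IsNode : Game → Set
IsNode G = ∃ λ Ls → ∃ λ Rs → G ≡ node Ls Rs

leftOption⇒IsNode : ∀ {G X} → X ∈ leftOpts G → IsNode G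
leftOption⇒IsNode {node Ls Rs} _ = Ls , Rs , refl

rightOption⇒IsNode : ∀ {G X} → X ∈ rightOpts G → IsNode G
rightOption⇒IsNode {node Ls Rs} _ = Ls , Rs , refl

IsNode-int : ∀ {G x} → IsNode G → G ≢ int x
IsNode-int (_ , _ , refl) ()

height-∈ : ∀ {X Gs} → X ∈ Gs → height X ≤ℕ heightL Gs
height-∈ {Gs = G ∷ Gs} (here refl)  = ℕ.m≤m⊔n _ _
height-∈ {Gs = G ∷ Gs} (there X∈Gs) = ℕ.m≤n⇒m≤o⊔n (height G) (height-∈ X∈Gs)

height-leftOption : ∀ {G X} → X ∈ leftOpts G → height X <ℕ height G
height-leftOption {node Ls Rs} X∈Ls = s≤s (ℕ.m≤n⇒m≤n⊔o (heightL Rs) (height-∈ X∈Ls))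

height-rightOption : ∀ {G X} → X ∈ rightOpts G → height X <ℕ height G
height-rightOption {node Ls Rs} X∈Rs = s≤s (ℕ.m≤n⇒m≤o⊔n (heightL Ls) (height-∈ X∈Rs))

-- Tuples of games

update-at : ∀ {n} (Gs : Fin n → Game) k X → update Gs k X k ≡ X
update-at Gs k X with k ≟ k
... | yes _   = refl
... | no k≢k = ⊥-elim (k≢k refl)

update-off : ∀ {n} (Gs : Fin n → Game) k X i → i ≢ k → update Gs k X i ≡ Gs i
update-off Gs k X i i≢k with i ≟ k
... | yes i≡k = ⊥-elim (i≢k i≡k)
... | no _    = refl

AgreeOff : ∀ {n} → Fin n → (Fin n → Game) → (Fin n → Game) → Set
AgreeOff k Gs Hs = ∀ i → i ≢ k → Gs i ≡ Hs i

update-agreeOff : ∀ {n} (Gs : Fin n → Game) k X → AgreeOff k Gs (update Gs k X)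
update-agreeOff Gs k X i i≢k = sym (update-off Gs k X i i≢k)

sumFin-mono : ∀ {n} {h h′ : Fin n → ℕ} → (∀ i → h i ≤ℕ h′ i) → sumFin h ≤ℕ sumFin h′
sumFin-mono {zero}  _    = z≤n
sumFin-mono {suc n} h≤h′ = ℕ.+-mono-≤ (h≤h′ zero) (sumFin-mono (h≤h′ ∘ suc))

sumFin-mono-< : ∀ {n} {h h′ : Fin n → ℕ} k → (∀ i → h i ≤ℕ h′ i) → h k <ℕ h′ k → sumFin h <ℕ sumFin h′
sumFin-mono-< zero    h≤h′ hk<h′k = ℕ.+-mono-<-≤ hk<h′k (sumFin-mono (h≤h′ ∘ suc))
sumFin-mono-< (suc k) h≤h′ hk<h′k = ℕ.+-mono-≤-< (h≤h′ zero) (sumFin-mono-< k (h≤h′ ∘ suc) hk<h′k)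

size : ∀ {n} → (Fin n → Game) → ℕ
size Gs = sumFin (height ∘ Gs)

size-update< : ∀ {n} (Gs : Fin n → Game) k X → height X <ℕ height (Gs k) → size (update Gs k X) <ℕ size Gs
size-update< Gs k X X<Gsk = sumFin-mono-< k height≤ (subst (λ Y → height Y <ℕ _) (sym (update-at Gs k X)) X<Gsk)
  where
  height≤ : ∀ i → height (update Gs k X i) ≤ℕ height (Gs i)
  height≤ i with i ≟ k
  ... | yes refl = ℕ.<⇒≤ X<Gsk
  ... | no _     = ℕ.≤-refl

size-int≤ : ∀ {n} {Gs Hs : Fin n → Game} {k x} → AgreeOff k Gs Hs → Hs k ≡ int x → size Hs ≤ℕ size Gs
size-int≤ {Gs = Gs} {Hs} {k} agree Hsk≡x = sumFin-mono height≤
  where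
  height≤ : ∀ i → height (Hs i) ≤ℕ height (Gs i)
  height≤ i with i ≟ k
  ... | yes refl rewrite Hsk≡x = z≤n
  ... | no i≢k   rewrite agree i i≢k = ℕ.≤-refl


_⊕_ : Tempo → Tempo → Tempo
even ⊕ q = q
odd  ⊕ q = flipT q

⊕-identityʳ : ∀ p → p ⊕ even ≡ p
⊕-identityʳ even = refl
⊕-identityʳ odd  = refl

flipT-⊕ˡ : ∀ p q → flipT p ⊕ q ≡ flipT (p ⊕ q)
flipT-⊕ˡ even q = refl
flipT-⊕ˡ odd  q = sym (flipT-involutive q)

flipT-⊕ʳ : ∀ p q → p ⊕ flipT q ≡ flipT (p ⊕ q)
flipT-⊕ʳ even q = refl
flipT-⊕ʳ odd  q = refl

parity : ∀ {n} → (Fin n → Game) → Tempo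
parity {zero}  Gs = even
parity {suc n} Gs = temper (Gs zero) ⊕ parity (Gs ∘ suc)

parity-cong : ∀ {n} {Gs Hs : Fin n → Game} → (∀ i → Gs i ≡ Hs i) → parity Gs ≡ parity Hs
parity-cong {zero}  Gs≡Hs = refl
parity-cong {suc n} Gs≡Hs = cong₂ _⊕_ (cong temper (Gs≡Hs zero)) (parity-cong (Gs≡Hs ∘ suc))

AgreeOff-suc : ∀ {n} {Gs Hs : Fin (suc n) → Game} {k} → AgreeOff (suc k) Gs Hs → AgreeOff k (Gs ∘ suc) (Hs ∘ suc)
AgreeOff-suc agree i i≢k = agree (suc i) (i≢k ∘ suc-injective)

parity-flip : ∀ {n} {Gs Hs : Fin n → Game} k → AgreeOff k Gs Hs →
              temper (Hs k) ≡ flipT (temper (Gs k)) → parity Hs ≡ flipT (parity Gs)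
parity-flip {suc n} {Gs} {Hs} zero agree Hsk-flips
  rewrite Hsk-flips | parity-cong {Gs = Hs ∘ suc} (λ i → sym (agree (suc i) λ ()))
  = flipT-⊕ˡ (temper (Gs zero)) _
parity-flip {suc n} {Gs} {Hs} (suc k) agree Hsk-flips
  rewrite agree zero (λ ()) | parity-flip k (AgreeOff-suc agree) Hsk-flips
  = flipT-⊕ʳ (temper (Hs zero)) _

parity-update : ∀ {n} (Gs : Fin n → Game) k X → temper X ≡ flipT (temper (Gs k)) →
                parity (update Gs k X) ≡ flipT (parity Gs)
parity-update Gs k X X-flips =
  parity-flip k (update-agreeOff Gs k X) (trans (cong temper (update-at Gs k X)) X-flips)

IsInt : Game → Set
IsInt G = ∃ λ x → G ≡ int x

parity-ints : ∀ {n} (Gs : Fin n → Game) → (∀ i → IsInt (Gs i)) → parity Gs ≡ even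
parity-ints {zero}  Gs ints = refl
parity-ints {suc n} Gs ints with ints zero
... | _ , eq rewrite eq = parity-ints (Gs ∘ suc) (ints ∘ suc)

parity-single : ∀ {n} (Gs : Fin n → Game) k → (∀ i → i ≢ k → IsInt (Gs i)) → parity Gs ≡ temper (Gs k)
parity-single {suc n} Gs zero ints
  rewrite parity-ints (Gs ∘ suc) (λ i → ints (suc i) λ ()) = ⊕-identityʳ (temper (Gs zero))
parity-single {suc n} Gs (suc k) ints with ints zero (λ ())
... | _ , eq rewrite eq = parity-single (Gs ∘ suc) k (λ i i≢k → ints (suc i) (i≢k ∘ suc-injective))

allInts-just : ∀ {n} (Gs : Fin n → Game) {xs} → allInts Gs ≡ just xs → ∀ i → Gs i ≡ int (xs i)
allInts-just {suc n} Gs eq i with Gs zero in eq₀ | allInts (Gs ∘ suc) in eq₊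
allInts-just {suc n} Gs refl zero    | int x    | just xs = eq₀
allInts-just {suc n} Gs refl (suc i) | int x    | just xs = allInts-just (Gs ∘ suc) eq₊ i
allInts-just {suc n} Gs ()   i       | int x    | nothing
allInts-just {suc n} Gs ()   i       | node _ _ | _

allInts-nothing : ∀ {n} (Gs : Fin n → Game) → allInts Gs ≡ nothing → ∃ λ i → IsNode (Gs i)
allInts-nothing {zero}  Gs ()
allInts-nothing {suc n} Gs eq with Gs zero in eq₀ | allInts (Gs ∘ suc) in eq₊
allInts-nothing {suc n} Gs () | int x     | just xs
allInts-nothing {suc n} Gs _  | int x     | nothing with allInts-nothing (Gs ∘ suc) eq₊
... | i , i-node = suc i , i-node
allInts-nothing {suc n} Gs _  | node Ls Rs | _ = zero , Ls , Rs , eq₀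

allInts-view : ∀ {n} (Gs : Fin n → Game) → (∃ λ xs → allInts Gs ≡ just xs) ⊎ allInts Gs ≡ nothing
allInts-view Gs with allInts Gs
... | just xs = inj₁ (xs , refl)
... | nothing = inj₂ refl

IsNode⇒allInts-nothing : ∀ {n} (Gs : Fin n → Game) j → IsNode (Gs j) → allInts Gs ≡ nothing
IsNode⇒allInts-nothing Gs j j-node with allInts-view Gs
... | inj₁ (xs , eq) = ⊥-elim (IsNode-int j-node (allInts-just Gs eq j))
... | inj₂ eq       = eq

allInts-parity : ∀ {n} (Gs : Fin n → Game) {xs} → allInts Gs ≡ just xs → parity Gs ≡ even
allInts-parity Gs {xs} eq = parity-ints Gs (λ i → xs i , allInts-just Gs eq i)

-- The extension

∈⇒≢[] : ∀ {A : Set} {x : A} {xs} → x ∈ xs → xs ≢ []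
∈⇒≢[] (here _)  ()
∈⇒≢[] (there _) ()

≢[]⇒∈ : ∀ {A : Set} {xs : List A} → xs ≢ [] → ∃ λ x → x ∈ xs
≢[]⇒∈ {xs = []}     xs≢[] = ⊥-elim (xs≢[] refl)
≢[]⇒∈ {xs = x ∷ xs} _     = x , here refl

leftOption-exists : ∀ {p G} → 𝓘 p G → IsNode G → ∃ λ X → X ∈ leftOpts G
leftOption-exists (node Ls≢[] _ _ _ _) (_ , _ , refl) = ≢[]⇒∈ Ls≢[]

rightOption-exists : ∀ {p G} → 𝓘 p G → IsNode G → ∃ λ X → X ∈ rightOpts G
rightOption-exists (node _ Rs≢[] _ _ _) (_ , _ , refl) = ≢[]⇒∈ Rs≢[]

Lo-attainedᴵ : ∀ {p G} → 𝓘 p G → IsNode G → ∃ λ X → X ∈ leftOpts G × Lo G ≡ Ro X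
Lo-attainedᴵ (node Ls≢[] _ _ _ _) (_ , _ , refl) = Lo-attained Ls≢[]

Ro-attainedᴵ : ∀ {p G} → 𝓘 p G → IsNode G → ∃ λ X → X ∈ rightOpts G × Ro G ≡ Lo X
Ro-attainedᴵ (node _ Rs≢[] _ _ _) (_ , _ , refl) = Ro-attained Rs≢[]

module _ {n : ℕ} (f : (Fin n → ℤ) → ℤ) where

  movesAt : ℕ → (Fin n → Game) → (Game → List Game) → Fin n → List Game
  movesAt m Gs opts i = map (λ X → extFuel m f (update Gs i X)) (opts (Gs i))

  moves : ℕ → (Fin n → Game) → (Game → List Game) → List Game
  moves m Gs opts = concatMap (movesAt m Gs opts) (allFin n)

  extFuel-ints : ∀ m Gs {xs} → allInts Gs ≡ just xs → extFuel (suc m) f Gs ≡ int (f xs)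
  extFuel-ints m Gs eq rewrite eq = refl

  extFuel-node : ∀ m Gs → allInts Gs ≡ nothing →
                 extFuel (suc m) f Gs ≡ node (moves m Gs leftOpts) (moves m Gs rightOpts)
  extFuel-node m Gs eq rewrite eq = refl

  ∈-moves⁺ : ∀ m Gs opts i {X} → X ∈ opts (Gs i) → extFuel m f (update Gs i X) ∈ moves m Gs opts
  ∈-moves⁺ m Gs opts i X∈ =
    ∈-concatMap⁺ (movesAt m Gs opts) {xs = allFin n} (Any.map (λ { refl → ∈-map⁺ _ X∈ }) (∈-allFin i))

  ∈-moves⁻ : ∀ m Gs opts {Y} → Y ∈ moves m Gs opts →
             ∃ λ i → ∃ λ X → X ∈ opts (Gs i) × Y ≡ extFuel m f (update Gs i X)
  ∈-moves⁻ m Gs opts Y∈ with Any.satisfied (∈-concatMap⁻ (movesAt m Gs opts) {xs = allFin n} Y∈)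
  ... | i , Y∈ᵢ with ∈-map⁻ _ Y∈ᵢ
  ...   | X , X∈ , eq = i , X , X∈ , eq

  moves-nonempty : ∀ m Gs opts → (∀ {p G} → 𝓘 p G → IsNode G → ∃ λ X → X ∈ opts G) →
                   (∀ i → 𝓘ₜ (Gs i)) → allInts Gs ≡ nothing → moves m Gs opts ≢ []
  moves-nonempty m Gs opts exists 𝓘Gs eq with allInts-nothing Gs eq
  ... | i , i-node = ∈⇒≢[] (∈-moves⁺ m Gs opts i (proj₂ (exists (𝓘Gs i) i-node)))

  Ro-leftMove≤Lo-ext : ∀ m Gs → allInts Gs ≡ nothing → ∀ i {X} → X ∈ leftOpts (Gs i) →
                       Ro (extFuel m f (update Gs i X)) ≤ Lo (extFuel (suc m) f Gs)
  Ro-leftMove≤Lo-ext m Gs eq i X∈ rewrite extFuel-node m Gs eq =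
    Ro-leftOption≤Lo {node _ _} (∈-moves⁺ m Gs leftOpts i X∈)

  Ro-ext≤Lo-rightMove : ∀ m Gs → allInts Gs ≡ nothing → ∀ i {X} → X ∈ rightOpts (Gs i) →
                        Ro (extFuel (suc m) f Gs) ≤ Lo (extFuel m f (update Gs i X))
  Ro-ext≤Lo-rightMove m Gs eq i X∈ rewrite extFuel-node m Gs eq =
    Ro≤Lo-rightOption {node _ _} (∈-moves⁺ m Gs rightOpts i X∈)

  Lo-ext-attained : ∀ m Gs → (∀ i → 𝓘ₜ (Gs i)) → allInts Gs ≡ nothing →
                    ∃ λ i → ∃ λ X → X ∈ leftOpts (Gs i) × Lo (extFuel (suc m) f Gs) ≡ Ro (extFuel m f (update Gs i X))
  Lo-ext-attained m Gs 𝓘Gs eq rewrite extFuel-node m Gs eq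
    with Lo-attained {Rs = moves m Gs rightOpts} (moves-nonempty m Gs leftOpts leftOption-exists 𝓘Gs eq)
  ... | Y , Y∈ , eqL with ∈-moves⁻ m Gs leftOpts Y∈
  ...   | i , X , X∈ , refl = i , X , X∈ , eqL

  Ro-ext-attained : ∀ m Gs → (∀ i → 𝓘ₜ (Gs i)) → allInts Gs ≡ nothing →
                    ∃ λ i → ∃ λ X → X ∈ rightOpts (Gs i) × Ro (extFuel (suc m) f Gs) ≡ Lo (extFuel m f (update Gs i X))
  Ro-ext-attained m Gs 𝓘Gs eq rewrite extFuel-node m Gs eq
    with Ro-attained {Ls = moves m Gs leftOpts} (moves-nonempty m Gs rightOpts rightOption-exists 𝓘Gs eq)
  ... | Y , Y∈ , eqR with ∈-moves⁻ m Gs rightOpts Y∈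
  ...   | i , X , X∈ , refl = i , X , X∈ , eqR

  extFuel-irrelevant : ∀ m m′ Gs → size Gs <ℕ m → size Gs <ℕ m′ → extFuel m f Gs ≡ extFuel m′ f Gs
  extFuel-irrelevant (suc m) (suc m′) Gs (s≤s size≤m) (s≤s size≤m′) with allInts Gs
  ... | just _  = refl
  ... | nothing = cong₂ node (moves-irrelevant leftOpts height-leftOption) (moves-irrelevant rightOpts height-rightOption)
    where
    moves-irrelevant : ∀ opts → (∀ {G X} → X ∈ opts G → height X <ℕ height G) → moves m Gs opts ≡ moves m′ Gs opts
    moves-irrelevant opts smaller = concatMap-cong (λ i → map-cong-local (All.tabulate λ X∈ →
      let size< = size-update< Gs i _ (smaller X∈) in
      extFuel-irrelevant m m′ _ (ℕ.<-≤-trans size< size≤m) (ℕ.<-≤-trans size< size≤m′))) (allFin n)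

-- Replacing a coordinate by an integer

module Comparison {n : ℕ} (S : Fin n → ℤ → Set) (f : (Fin n → ℤ) → ℤ) (mono : OrderPreserving n S f) where

  f̃ : ℕ → (Fin n → Game) → Game
  f̃ m Gs = extFuel m f Gs

  Admissible : (Fin n → Game) → Set
  Admissible Gs = (∀ i → 𝓘ₜ (Gs i)) × (∀ i → Valued (S i) (Gs i))

  admissible-update : ∀ {Gs} → Admissible Gs → ∀ k {X} → 𝓘ₜ X → Valued (S k) X → Admissible (update Gs k X)
  admissible-update {Gs} (𝓘Gs , vGs) k {X} 𝓘X vX = 𝓘Gs′ , vGs′
    where
    𝓘Gs′ : ∀ i → 𝓘ₜ (update Gs k X i)
    𝓘Gs′ i with i ≟ k
    ... | yes refl = 𝓘X
    ... | no _     = 𝓘Gs i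
    vGs′ : ∀ i → Valued (S i) (update Gs k X i)
    vGs′ i with i ≟ k
    ... | yes refl = vX
    ... | no _     = vGs i

  record Move (m : ℕ) (Gs Gs′ : Fin n → Game) : Set where
    field
      admissible   : Admissible Gs′
      fuel         : size Gs′ <ℕ m
      parity-flips : parity Gs′ ≡ flipT (parity Gs)

  leftMove : ∀ {m Gs} → size Gs <ℕ suc m → Admissible Gs → ∀ j {X} → X ∈ leftOpts (Gs j) → Move m Gs (update Gs j X)
  leftMove {Gs = Gs} (s≤s size≤m) adm j {X} X∈ = record
    { admissible   = admissible-update adm j 𝓘X (leftOption-valued (proj₂ adm j) X∈)
    ; fuel         = ℕ.<-≤-trans (size-update< Gs j X (height-leftOption X∈)) size≤m
    ; parity-flips = parity-update Gs j X X-flips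
    }
    where 𝓘X      = proj₁ (leftOption-𝓘ₜ (proj₁ adm j) X∈)
          X-flips = proj₂ (leftOption-𝓘ₜ (proj₁ adm j) X∈)

  rightMove : ∀ {m Gs} → size Gs <ℕ suc m → Admissible Gs → ∀ j {X} → X ∈ rightOpts (Gs j) → Move m Gs (update Gs j X)
  rightMove {Gs = Gs} (s≤s size≤m) adm j {X} X∈ = record
    { admissible   = admissible-update adm j 𝓘X (rightOption-valued (proj₂ adm j) X∈)
    ; fuel         = ℕ.<-≤-trans (size-update< Gs j X (height-rightOption X∈)) size≤m
    ; parity-flips = parity-update Gs j X X-flips
    }
    where 𝓘X      = proj₁ (rightOption-𝓘ₜ (proj₁ adm j) X∈)
          X-flips = proj₂ (rightOption-𝓘ₜ (proj₁ adm j) X∈)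

  record Replaced (k : Fin n) (c : ℤ) (Gs Hs : Fin n → Game) : Set where
    field
      agree  : AgreeOff k Gs Hs
      at     : Hs k ≡ int c
      valued : S k c

  open Replaced

  replaced-admissible : ∀ {Gs Hs k c} → Admissible Gs → Replaced k c Gs Hs → Admissible Hs
  replaced-admissible {Gs} {Hs} {k} (𝓘Gs , vGs) rep = 𝓘Hs , vHs
    where
    𝓘Hs : ∀ i → 𝓘ₜ (Hs i)
    𝓘Hs i with i ≟ k
    ... | yes refl rewrite at rep = int
    ... | no i≢k   = subst 𝓘ₜ (agree rep i i≢k) (𝓘Gs i)
    vHs : ∀ i → Valued (S i) (Hs i)
    vHs i with i ≟ k
    ... | yes refl rewrite at rep = int (valued rep)
    ... | no i≢k   = subst (Valued (S i)) (agree rep i i≢k) (vGs i)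

  replaced-update-off : ∀ {Gs Hs k c} → Replaced k c Gs Hs → ∀ j X → j ≢ k →
                        Replaced k c (update Gs j X) (update Hs j X)
  replaced-update-off {Gs} {Hs} {k} rep j X j≢k = record
    { agree  = agree′
    ; at     = trans (update-off Hs j X k (j≢k ∘ sym)) (at rep)
    ; valued = valued rep
    }
    where
    agree′ : AgreeOff k (update Gs j X) (update Hs j X)
    agree′ i i≢k with i ≟ j
    ... | yes _ = refl
    ... | no _  = agree rep i i≢k

  replaced-update-at : ∀ {Gs Hs k c} → Replaced k c Gs Hs → ∀ X → Replaced k c (update Gs k X) Hs
  replaced-update-at {Gs} {k = k} rep X = record
    { agree  = λ i i≢k → trans (update-off Gs k X i i≢k) (agree rep i i≢k)
    ; at     = at rep
    ; valued = valued rep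
    }

  replaced-ints : ∀ {Gs Hs k c ys} → Replaced k c Gs Hs → allInts Gs ≡ just ys → ∃ λ xs → allInts Hs ≡ just xs
  replaced-ints {Gs} {Hs} {k} rep eq with allInts-view Hs
  ... | inj₁ ints = ints
  ... | inj₂ eqH with allInts-nothing Hs eqH
  ...   | j , j-node with j ≟ k
  ...     | yes refl = ⊥-elim (IsNode-int j-node (at rep))
  ...     | no j≢k   = ⊥-elim (IsNode-int j-node (trans (sym (agree rep j j≢k)) (allInts-just Gs eq j)))

  replaced-single-node : ∀ {Gs Hs k c xs} → Replaced k c Gs Hs → allInts Hs ≡ just xs → allInts Gs ≡ nothing →
                         IsNode (Gs k) × (∀ i → i ≢ k → IsInt (Gs i))
  replaced-single-node {Gs} {Hs} {k} {xs = xs} rep eqH eq with allInts-nothing Gs eq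
  ... | j , j-node with j ≟ k
  ...   | yes refl = j-node , λ i i≢k → xs i , trans (agree rep i i≢k) (allInts-just Hs eqH i)
  ...   | no j≢k   = ⊥-elim (IsNode-int j-node (trans (agree rep j j≢k) (allInts-just Hs eqH j)))

  replaced-value : ∀ {Gs Hs k c xs} → Replaced k c Gs Hs → allInts Hs ≡ just xs → xs k ≡ c
  replaced-value {Hs = Hs} {k} rep eq = cong Ro (trans (sym (allInts-just Hs eq k)) (at rep))

  replaced-fuel : ∀ {m Gs Hs k c} → Replaced k c Gs Hs → size Gs <ℕ m → size Hs <ℕ m
  replaced-fuel rep = ℕ.≤-<-trans (size-int≤ (agree rep) (at rep))

  replacedByRo : ∀ {Gs} → Admissible Gs → ∀ k → Replaced k (Ro (Gs k)) Gs (update Gs k (int (Ro (Gs k))))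
  replacedByRo {Gs} (𝓘Gs , vGs) k = record
    { agree  = update-agreeOff Gs k _
    ; at     = update-at Gs k _
    ; valued = Ro-valued (𝓘⇒WT (𝓘Gs k)) (vGs k)
    }

  f̃-ints : ∀ {m Gs xs} → size Gs <ℕ m → allInts Gs ≡ just xs → f̃ m Gs ≡ int (f xs)
  f̃-ints {suc m} {Gs} _ eq = extFuel-ints f m Gs eq

  f-mono-ints : ∀ {Gs Hs k xs ys} → (∀ i → Valued (S i) (Gs i)) → (∀ i → Valued (S i) (Hs i)) →
                AgreeOff k Gs Hs → allInts Gs ≡ just xs → allInts Hs ≡ just ys → xs k ≤ ys k → f xs ≤ f ys
  f-mono-ints {Gs} {Hs} {k} {xs} {ys} vGs vHs agree eqG eqH xk≤yk =
    mono xs ys (λ i → int-valued (subst (Valued (S i)) (allInts-just Gs eqG i) (vGs i)))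
               (λ i → int-valued (subst (Valued (S i)) (allInts-just Hs eqH i) (vHs i))) x≤y
    where
    int-valued : ∀ {P : ℤ → Set} {x} → Valued P (int x) → P x
    int-valued (int p) = p
    x≤y : ∀ i → xs i ≤ ys i
    x≤y i with i ≟ k
    ... | yes refl = xk≤yk
    ... | no i≢k   = ≤-reflexive (cong Ro (trans (sym (allInts-just Gs eqG i)) (trans (agree i i≢k) (allInts-just Hs eqH i))))

  NodeParity : Fin n → Tempo → (Fin n → Game) → Set
  NodeParity k p Gs = IsNode (Gs k) → parity Gs ≡ p

  nodeParity-move : ∀ {m Gs Gs′ k p} → Move m Gs Gs′ → Gs′ k ≡ Gs k → NodeParity k p Gs → NodeParity k (flipT p) Gs′
  nodeParity-move mv Gs′k≡ np k-node = trans (Move.parity-flips mv) (cong flipT (np (subst IsNode Gs′k≡ k-node)))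

  nodeParity-int : ∀ {Gs k x p} → Gs k ≡ int x → NodeParity k p Gs
  nodeParity-int Gsk≡x k-node = ⊥-elim (IsNode-int k-node Gsk≡x)

  agreeOff-sym : ∀ {Gs Hs : Fin n → Game} k → AgreeOff k Gs Hs → AgreeOff k Hs Gs
  agreeOff-sym k agree i i≢k = sym (agree i i≢k)

  open ≤-Reasoning

  mutual
    Lo-replaced≤ : ∀ {m Gs Hs k c} → size Gs <ℕ m → Admissible Gs → Replaced k c Gs Hs →
                   NodeParity k even Gs → c ≤ Ro (Gs k) → Lo (f̃ m Hs) ≤ Lo (f̃ m Gs)
    Lo-replaced≤ {suc m} {Gs} {Hs} {k} {c} fuel adm rep np c≤ with allInts-view Hs
    ... | inj₁ (xs , eqH) with allInts-view Gs
    ...   | inj₁ (ys , eqG) = begin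
            Lo (f̃ (suc m) Hs) ≡⟨ cong Lo (f̃-ints (replaced-fuel rep fuel) eqH) ⟩
            f xs              ≤⟨ f-mono-ints (proj₂ (replaced-admissible adm rep)) (proj₂ adm) (agreeOff-sym k (agree rep)) eqH eqG
                                   (subst₂ _≤_ (sym (replaced-value rep eqH)) (cong Ro (allInts-just Gs eqG k)) c≤) ⟩
            f ys              ≡⟨ cong Lo (f̃-ints fuel eqG) ⟨
            Lo (f̃ (suc m) Gs) ∎
    ...   | inj₂ eqG with replaced-single-node rep eqH eqG
    ...     | k-node , others with Lo-attainedᴵ (proj₁ adm k) k-node
    ...       | X , X∈ , Lo≡ = begin
            Lo (f̃ (suc m) Hs)        ≡⟨ cong Lo (f̃-ints (replaced-fuel rep fuel) eqH) ⟩
            f xs                     ≡⟨ cong Ro (f̃-ints (replaced-fuel rep′ (Move.fuel mv)) eqH) ⟨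
            Ro (f̃ m Hs)              ≤⟨ Ro-replaced≤ (Move.fuel mv) (Move.admissible mv) rep′ (λ _ → odd≡) c≤′ ⟩
            Ro (f̃ m (update Gs k X)) ≤⟨ Ro-leftMove≤Lo-ext f m Gs eqG k X∈ ⟩
            Lo (f̃ (suc m) Gs)        ∎
      where
      mv   = leftMove fuel adm k X∈
      rep′ = replaced-update-at rep X
      odd≡ = trans (Move.parity-flips mv) (cong flipT (np k-node))
      -- Gs k is the only non-integer coordinate, so its temper is the (even) parity of the tuple.
      c≤′ : c ≤ Ro (update Gs k X k)
      c≤′ = subst (c ≤_) (cong Ro (sym (update-at Gs k X))) (begin
        c          ≤⟨ c≤ ⟩
        Ro (Gs k)  ≤⟨ 𝓘ₜ-even⇒Ro≤Lo (proj₁ adm k) (trans (sym (parity-single Gs k others)) (np k-node)) ⟩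
        Lo (Gs k)  ≡⟨ Lo≡ ⟩
        Ro X       ∎)
    Lo-replaced≤ {suc m} {Gs} {Hs} {k} {c} fuel adm rep np c≤ | inj₂ eqH
      with Lo-ext-attained f m Hs (proj₁ (replaced-admissible adm rep)) eqH
    ... | j , X , X∈H , Lo≡ with j ≟ k
    ...   | yes refl = ⊥-elim (IsNode-int (leftOption⇒IsNode X∈H) (at rep))
    ...   | no j≢k   = begin
            Lo (f̃ (suc m) Hs)        ≡⟨ Lo≡ ⟩
            Ro (f̃ m (update Hs j X)) ≤⟨ Ro-replaced≤ (Move.fuel mv) (Move.admissible mv) (replaced-update-off rep j X j≢k)
                                          (nodeParity-move mv (update-off Gs j X k (j≢k ∘ sym)) np)
                                          (subst (c ≤_) (cong Ro (sym (update-off Gs j X k (j≢k ∘ sym)))) c≤) ⟩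
            Ro (f̃ m (update Gs j X)) ≤⟨ Ro-leftMove≤Lo-ext f m Gs (IsNode⇒allInts-nothing Gs j (leftOption⇒IsNode X∈)) j X∈ ⟩
            Lo (f̃ (suc m) Gs)        ∎
      where
      X∈ : X ∈ leftOpts (Gs j)
      X∈ = subst (λ G → X ∈ leftOpts G) (sym (agree rep j j≢k)) X∈H
      mv = leftMove fuel adm j X∈

    Ro-replaced≤ : ∀ {m Gs Hs k c} → size Gs <ℕ m → Admissible Gs → Replaced k c Gs Hs →
                   NodeParity k odd Gs → c ≤ Ro (Gs k) → Ro (f̃ m Hs) ≤ Ro (f̃ m Gs)
    Ro-replaced≤ {suc m} {Gs} {Hs} {k} {c} fuel adm rep np c≤ with allInts-view Gs
    ... | inj₁ (ys , eqG) with replaced-ints rep eqG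
    ...   | xs , eqH = begin
            Ro (f̃ (suc m) Hs) ≡⟨ cong Ro (f̃-ints (replaced-fuel rep fuel) eqH) ⟩
            f xs              ≤⟨ f-mono-ints (proj₂ (replaced-admissible adm rep)) (proj₂ adm) (agreeOff-sym k (agree rep)) eqH eqG
                                   (subst₂ _≤_ (sym (replaced-value rep eqH)) (cong Ro (allInts-just Gs eqG k)) c≤) ⟩
            f ys              ≡⟨ cong Ro (f̃-ints fuel eqG) ⟨
            Ro (f̃ (suc m) Gs) ∎
    Ro-replaced≤ {suc m} {Gs} {Hs} {k} {c} fuel adm rep np c≤ | inj₂ eqG
      with Ro-ext-attained f m Gs (proj₁ adm) eqG
    ... | j , X , X∈ , Ro≡ with j ≟ k
    ...   | yes refl = begin
            Ro (f̃ (suc m) Hs)        ≤⟨ Ro-replaced≤rightMoveAt fuel adm rep (np (rightOption⇒IsNode X∈)) c≤ X∈ ⟩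
            Lo (f̃ m (update Gs k X)) ≡⟨ Ro≡ ⟨
            Ro (f̃ (suc m) Gs)        ∎
    ...   | no j≢k   = begin
            Ro (f̃ (suc m) Hs)        ≤⟨ Ro-ext≤Lo-rightMove f m Hs (IsNode⇒allInts-nothing Hs j (rightOption⇒IsNode X∈H)) j X∈H ⟩
            Lo (f̃ m (update Hs j X)) ≤⟨ Lo-replaced≤ (Move.fuel mv) (Move.admissible mv) (replaced-update-off rep j X j≢k)
                                          (nodeParity-move mv (update-off Gs j X k (j≢k ∘ sym)) np)
                                          (subst (c ≤_) (cong Ro (sym (update-off Gs j X k (j≢k ∘ sym)))) c≤) ⟩
            Lo (f̃ m (update Gs j X)) ≡⟨ Ro≡ ⟨
            Ro (f̃ (suc m) Gs)        ∎
      where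
      X∈H : X ∈ rightOpts (Hs j)
      X∈H = subst (λ G → X ∈ rightOpts G) (agree rep j j≢k) X∈
      mv = rightMove fuel adm j X∈

    Ro-replaced≤rightMoveAt : ∀ {m Gs Hs k c X} → size Gs <ℕ suc m → Admissible Gs → Replaced k c Gs Hs →
                              parity Gs ≡ odd → c ≤ Ro (Gs k) → X ∈ rightOpts (Gs k) →
                              Ro (f̃ (suc m) Hs) ≤ Lo (f̃ m (update Gs k X))
    Ro-replaced≤rightMoveAt {m} {Gs} {Hs} {k} {c} {int x} fuel adm rep odd≡ c≤ X∈ = begin
        Ro (f̃ (suc m) Hs) ≡⟨ cong Ro (extFuel-irrelevant f (suc m) m Hs (replaced-fuel rep fuel) (replaced-fuel rep′ (Move.fuel mv))) ⟩
        Ro (f̃ m Hs)       ≤⟨ Ro-replaced≤ (Move.fuel mv) (Move.admissible mv) rep′ (nodeParity-int {k = k} (update-at Gs k (int x)))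
                               (subst (c ≤_) (cong Ro (sym (update-at Gs k (int x)))) (≤-trans c≤ (Ro≤Lo-rightOption {Gs k} X∈))) ⟩
        Ro (f̃ m Gs′)      ≤⟨ Ro≤Lo-ext (Move.fuel mv) (Move.admissible mv) (trans (Move.parity-flips mv) (cong flipT odd≡)) ⟩
        Lo (f̃ m Gs′)      ∎
      where
      Gs′  = update Gs k (int x)
      mv   = rightMove fuel adm k X∈
      rep′ = replaced-update-at rep (int x)
    Ro-replaced≤rightMoveAt {zero} {Gs} {k = k} {X = node _ _} fuel adm rep odd≡ c≤ X∈ =
      ⊥-elim (ℕ.n≮0 (Move.fuel (rightMove fuel adm k X∈)))
    Ro-replaced≤rightMoveAt {suc m} {Gs} {Hs} {k} {c} {node Ls Rs} fuel adm rep odd≡ c≤ X∈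
      with Lo-attainedᴵ (proj₁ (rightOption-𝓘ₜ (proj₁ adm k) X∈)) (Ls , Rs , refl)
    ... | Y , Y∈X , Lo≡ = begin
        Ro (f̃ (suc (suc m)) Hs) ≡⟨ cong Ro (extFuel-irrelevant f (suc (suc m)) m Hs (replaced-fuel rep fuel) (replaced-fuel rep″ (Move.fuel mv′))) ⟩
        Ro (f̃ m Hs)             ≤⟨ Ro-replaced≤ (Move.fuel mv′) (Move.admissible mv′) rep″ (λ _ → odd≡″) c≤″ ⟩
        Ro (f̃ m Gs″)            ≤⟨ Ro-leftMove≤Lo-ext f m Gs′ (IsNode⇒allInts-nothing Gs′ k (leftOption⇒IsNode Y∈)) k Y∈ ⟩
        Lo (f̃ (suc m) Gs′)      ∎
      where
      X    = node Ls Rs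
      Gs′  = update Gs k X
      mv   = rightMove fuel adm k X∈
      Y∈ : Y ∈ leftOpts (Gs′ k)
      Y∈   = subst (λ G → Y ∈ leftOpts G) (sym (update-at Gs k X)) Y∈X
      Gs″  = update Gs′ k Y
      mv′  = leftMove (Move.fuel mv) (Move.admissible mv) k Y∈
      rep″ = replaced-update-at (replaced-update-at rep X) Y
      odd≡″ = trans (Move.parity-flips mv′) (cong flipT (trans (Move.parity-flips mv) (cong flipT odd≡)))
      c≤″ : c ≤ Ro (Gs″ k)
      c≤″ = subst (c ≤_) (cong Ro (sym (update-at Gs′ k Y))) (≤-trans c≤ (≤-trans (Ro≤Lo-rightOption {Gs k} X∈) (≤-reflexive Lo≡)))

    Lo≤replaced : ∀ {m Gs Hs k c} → size Gs <ℕ m → Admissible Gs → Replaced k c Gs Hs →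
                  NodeParity k odd Gs → Lo (Gs k) ≤ c → Lo (f̃ m Gs) ≤ Lo (f̃ m Hs)
    Lo≤replaced {suc m} {Gs} {Hs} {k} {c} fuel adm rep np ≤c with allInts-view Gs
    ... | inj₁ (ys , eqG) with replaced-ints rep eqG
    ...   | xs , eqH = begin
            Lo (f̃ (suc m) Gs) ≡⟨ cong Lo (f̃-ints fuel eqG) ⟩
            f ys              ≤⟨ f-mono-ints (proj₂ adm) (proj₂ (replaced-admissible adm rep)) (agree rep) eqG eqH
                                   (subst₂ _≤_ (cong Lo (allInts-just Gs eqG k)) (sym (replaced-value rep eqH)) ≤c) ⟩
            f xs              ≡⟨ cong Lo (f̃-ints (replaced-fuel rep fuel) eqH) ⟨
            Lo (f̃ (suc m) Hs) ∎
    Lo≤replaced {suc m} {Gs} {Hs} {k} {c} fuel adm rep np ≤c | inj₂ eqG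
      with Lo-ext-attained f m Gs (proj₁ adm) eqG
    ... | j , X , X∈ , Lo≡ with j ≟ k
    ...   | yes refl = begin
            Lo (f̃ (suc m) Gs)        ≡⟨ Lo≡ ⟩
            Ro (f̃ m (update Gs k X)) ≤⟨ leftMoveAt≤Lo-replaced fuel adm rep (np (leftOption⇒IsNode X∈)) ≤c X∈ ⟩
            Lo (f̃ (suc m) Hs)        ∎
    ...   | no j≢k   = begin
            Lo (f̃ (suc m) Gs)        ≡⟨ Lo≡ ⟩
            Ro (f̃ m (update Gs j X)) ≤⟨ Ro≤replaced (Move.fuel mv) (Move.admissible mv) (replaced-update-off rep j X j≢k)
                                          (nodeParity-move mv (update-off Gs j X k (j≢k ∘ sym)) np)
                                          (subst (_≤ c) (cong Lo (sym (update-off Gs j X k (j≢k ∘ sym)))) ≤c) ⟩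
            Ro (f̃ m (update Hs j X)) ≤⟨ Ro-leftMove≤Lo-ext f m Hs (IsNode⇒allInts-nothing Hs j (leftOption⇒IsNode X∈H)) j X∈H ⟩
            Lo (f̃ (suc m) Hs)        ∎
      where
      X∈H : X ∈ leftOpts (Hs j)
      X∈H = subst (λ G → X ∈ leftOpts G) (agree rep j j≢k) X∈
      mv = leftMove fuel adm j X∈

    leftMoveAt≤Lo-replaced : ∀ {m Gs Hs k c X} → size Gs <ℕ suc m → Admissible Gs → Replaced k c Gs Hs →
                             parity Gs ≡ odd → Lo (Gs k) ≤ c → X ∈ leftOpts (Gs k) →
                             Ro (f̃ m (update Gs k X)) ≤ Lo (f̃ (suc m) Hs)
    leftMoveAt≤Lo-replaced {m} {Gs} {Hs} {k} {c} {int x} fuel adm rep odd≡ ≤c X∈ = begin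
        Ro (f̃ m Gs′)      ≤⟨ Ro≤Lo-ext (Move.fuel mv) (Move.admissible mv) (trans (Move.parity-flips mv) (cong flipT odd≡)) ⟩
        Lo (f̃ m Gs′)      ≤⟨ Lo≤replaced (Move.fuel mv) (Move.admissible mv) rep′ (nodeParity-int {k = k} (update-at Gs k (int x)))
                               (subst (_≤ c) (cong Lo (sym (update-at Gs k (int x)))) (≤-trans (Ro-leftOption≤Lo {Gs k} X∈) ≤c)) ⟩
        Lo (f̃ m Hs)       ≡⟨ cong Lo (extFuel-irrelevant f m (suc m) Hs (replaced-fuel rep′ (Move.fuel mv)) (replaced-fuel rep fuel)) ⟩
        Lo (f̃ (suc m) Hs) ∎
      where
      Gs′  = update Gs k (int x)
      mv   = leftMove fuel adm k X∈
      rep′ = replaced-update-at rep (int x)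
    leftMoveAt≤Lo-replaced {zero} {Gs} {k = k} {X = node _ _} fuel adm rep odd≡ ≤c X∈ =
      ⊥-elim (ℕ.n≮0 (Move.fuel (leftMove fuel adm k X∈)))
    leftMoveAt≤Lo-replaced {suc m} {Gs} {Hs} {k} {c} {node Ls Rs} fuel adm rep odd≡ ≤c X∈
      with Ro-attainedᴵ (proj₁ (leftOption-𝓘ₜ (proj₁ adm k) X∈)) (Ls , Rs , refl)
    ... | Y , Y∈X , Ro≡ = begin
        Ro (f̃ (suc m) Gs′)      ≤⟨ Ro-ext≤Lo-rightMove f m Gs′ (IsNode⇒allInts-nothing Gs′ k (rightOption⇒IsNode Y∈)) k Y∈ ⟩
        Lo (f̃ m Gs″)            ≤⟨ Lo≤replaced (Move.fuel mv′) (Move.admissible mv′) rep″ (λ _ → odd≡″) ≤c″ ⟩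
        Lo (f̃ m Hs)             ≡⟨ cong Lo (extFuel-irrelevant f m (suc (suc m)) Hs (replaced-fuel rep″ (Move.fuel mv′)) (replaced-fuel rep fuel)) ⟩
        Lo (f̃ (suc (suc m)) Hs) ∎
      where
      X    = node Ls Rs
      Gs′  = update Gs k X
      mv   = leftMove fuel adm k X∈
      Y∈ : Y ∈ rightOpts (Gs′ k)
      Y∈   = subst (λ G → Y ∈ rightOpts G) (sym (update-at Gs k X)) Y∈X
      Gs″  = update Gs′ k Y
      mv′  = rightMove (Move.fuel mv) (Move.admissible mv) k Y∈
      rep″ = replaced-update-at (replaced-update-at rep X) Y
      odd≡″ = trans (Move.parity-flips mv′) (cong flipT (trans (Move.parity-flips mv) (cong flipT odd≡)))
      ≤c″ : Lo (Gs″ k) ≤ c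
      ≤c″ = subst (_≤ c) (cong Lo (sym (update-at Gs′ k Y))) (≤-trans (≤-reflexive (sym Ro≡)) (≤-trans (Ro-leftOption≤Lo {Gs k} X∈) ≤c))

    Ro≤replaced : ∀ {m Gs Hs k c} → size Gs <ℕ m → Admissible Gs → Replaced k c Gs Hs →
                  NodeParity k even Gs → Lo (Gs k) ≤ c → Ro (f̃ m Gs) ≤ Ro (f̃ m Hs)
    Ro≤replaced {suc m} {Gs} {Hs} {k} {c} fuel adm rep np ≤c with allInts-view Hs
    ... | inj₁ (xs , eqH) with allInts-view Gs
    ...   | inj₁ (ys , eqG) = begin
            Ro (f̃ (suc m) Gs) ≡⟨ cong Ro (f̃-ints fuel eqG) ⟩
            f ys              ≤⟨ f-mono-ints (proj₂ adm) (proj₂ (replaced-admissible adm rep)) (agree rep) eqG eqH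
                                   (subst₂ _≤_ (cong Lo (allInts-just Gs eqG k)) (sym (replaced-value rep eqH)) ≤c) ⟩
            f xs              ≡⟨ cong Ro (f̃-ints (replaced-fuel rep fuel) eqH) ⟨
            Ro (f̃ (suc m) Hs) ∎
    ...   | inj₂ eqG with replaced-single-node rep eqH eqG
    ...     | k-node , others with Ro-attainedᴵ (proj₁ adm k) k-node
    ...       | X , X∈ , Ro≡ = begin
            Ro (f̃ (suc m) Gs)        ≤⟨ Ro-ext≤Lo-rightMove f m Gs eqG k X∈ ⟩
            Lo (f̃ m (update Gs k X)) ≤⟨ Lo≤replaced (Move.fuel mv) (Move.admissible mv) rep′ (λ _ → odd≡) ≤c′ ⟩
            Lo (f̃ m Hs)              ≡⟨ cong Lo (f̃-ints (replaced-fuel rep′ (Move.fuel mv)) eqH) ⟩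
            f xs                     ≡⟨ cong Ro (f̃-ints (replaced-fuel rep fuel) eqH) ⟨
            Ro (f̃ (suc m) Hs)        ∎
      where
      mv   = rightMove fuel adm k X∈
      rep′ = replaced-update-at rep X
      odd≡ = trans (Move.parity-flips mv) (cong flipT (np k-node))
      ≤c′ : Lo (update Gs k X k) ≤ c
      ≤c′ = subst (_≤ c) (cong Lo (sym (update-at Gs k X))) (begin
        Lo X       ≡⟨ Ro≡ ⟨
        Ro (Gs k)  ≤⟨ 𝓘ₜ-even⇒Ro≤Lo (proj₁ adm k) (trans (sym (parity-single Gs k others)) (np k-node)) ⟩
        Lo (Gs k)  ≤⟨ ≤c ⟩
        c          ∎)
    Ro≤replaced {suc m} {Gs} {Hs} {k} {c} fuel adm rep np ≤c | inj₂ eqH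
      with Ro-ext-attained f m Hs (proj₁ (replaced-admissible adm rep)) eqH
    ... | j , X , X∈H , Ro≡ with j ≟ k
    ...   | yes refl = ⊥-elim (IsNode-int (rightOption⇒IsNode X∈H) (at rep))
    ...   | no j≢k   = begin
            Ro (f̃ (suc m) Gs)        ≤⟨ Ro-ext≤Lo-rightMove f m Gs (IsNode⇒allInts-nothing Gs j (rightOption⇒IsNode X∈)) j X∈ ⟩
            Lo (f̃ m (update Gs j X)) ≤⟨ Lo≤replaced (Move.fuel mv) (Move.admissible mv) (replaced-update-off rep j X j≢k)
                                          (nodeParity-move mv (update-off Gs j X k (j≢k ∘ sym)) np)
                                          (subst (_≤ c) (cong Lo (sym (update-off Gs j X k (j≢k ∘ sym)))) ≤c) ⟩
            Lo (f̃ m (update Hs j X)) ≡⟨ Ro≡ ⟨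
            Ro (f̃ (suc m) Hs)        ∎
      where
      X∈ : X ∈ rightOpts (Gs j)
      X∈ = subst (λ G → X ∈ rightOpts G) (sym (agree rep j j≢k)) X∈H
      mv = rightMove fuel adm j X∈

    Ro≤Lo-replacedByRo : ∀ {m Gs} → size Gs <ℕ m → (adm : Admissible Gs) → parity Gs ≡ even → ∀ k → IsNode (Gs k) →
                         Ro (f̃ m Gs) ≤ Lo (f̃ m (update Gs k (int (Ro (Gs k)))))
    Ro≤Lo-replacedByRo {suc m} {Gs} fuel adm even≡ k k-node with Ro-attainedᴵ (proj₁ adm k) k-node
    ... | X , X∈ , Ro≡ = begin
        Ro (f̃ (suc m) Gs)        ≤⟨ Ro-ext≤Lo-rightMove f m Gs (IsNode⇒allInts-nothing Gs k k-node) k X∈ ⟩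
        Lo (f̃ m (update Gs k X)) ≤⟨ Lo≤replaced (Move.fuel mv) (Move.admissible mv) rep (λ _ → trans (Move.parity-flips mv) (cong flipT even≡))
                                      (≤-reflexive (trans (cong Lo (update-at Gs k X)) (sym Ro≡))) ⟩
        Lo (f̃ m Hs)              ≡⟨ cong Lo (extFuel-irrelevant f m (suc m) Hs (replaced-fuel rep (Move.fuel mv)) (replaced-fuel (replacedByRo adm k) fuel)) ⟩
        Lo (f̃ (suc m) Hs)        ∎
      where
      Hs  = update Gs k (int (Ro (Gs k)))
      mv  = rightMove fuel adm k X∈
      rep = replaced-update-at (replacedByRo adm k) X

    Ro≤Lo-ext : ∀ {m Gs} → size Gs <ℕ m → Admissible Gs → parity Gs ≡ even → Ro (f̃ m Gs) ≤ Lo (f̃ m Gs)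
    Ro≤Lo-ext {m} {Gs} fuel adm even≡ with allInts-view Gs
    ... | inj₁ (ys , eqG) = subst (λ G → Ro G ≤ Lo G) (sym (f̃-ints fuel eqG)) ≤-refl
    ... | inj₂ eqG with allInts-nothing Gs eqG
    ...   | k , k-node = begin
        Ro (f̃ m Gs)                           ≤⟨ Ro≤Lo-replacedByRo fuel adm even≡ k k-node ⟩
        Lo (f̃ m (update Gs k (int (Ro (Gs k))))) ≤⟨ Lo-replaced≤ fuel adm (replacedByRo adm k) (λ _ → even≡) ≤-refl ⟩
        Lo (f̃ m Gs)                           ∎

  𝓘-ext : ∀ {m Gs} → size Gs <ℕ m → Admissible Gs → 𝓘 (parity Gs) (f̃ m Gs)
  𝓘-ext {suc m} {Gs} fuel adm with allInts-view Gs
  ... | inj₁ (ys , eqG) = subst₂ 𝓘 (sym (allInts-parity Gs eqG)) (sym (extFuel-ints f m Gs eqG)) int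
  ... | inj₂ eqG = subst (𝓘 (parity Gs)) (sym (extFuel-node f m Gs eqG))
        (node (moves-nonempty f m Gs leftOpts leftOption-exists (proj₁ adm) eqG)
              (moves-nonempty f m Gs rightOpts rightOption-exists (proj₁ adm) eqG)
              (All.tabulate (𝓘-move leftOpts leftMove))
              (All.tabulate (𝓘-move rightOpts rightMove))
              (λ even≡ → subst (λ G → Ro G ≤ Lo G) (extFuel-node f m Gs eqG) (Ro≤Lo-ext fuel adm even≡)))
    where
    𝓘-move : ∀ opts → (∀ {Gs} → size Gs <ℕ suc m → Admissible Gs → ∀ j {X} → X ∈ opts (Gs j) → Move m Gs (update Gs j X)) →
             ∀ {Y} → Y ∈ moves f m Gs opts → 𝓘 (flipT (parity Gs)) Y
    𝓘-move opts move Y∈ with ∈-moves⁻ f m Gs opts Y∈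
    ... | j , X , X∈ , refl = subst (λ p → 𝓘 p (f̃ m (update Gs j X))) (Move.parity-flips mv) (𝓘-ext (Move.fuel mv) (Move.admissible mv))
      where mv = move fuel adm j X∈

mainTheorem10 : (n : ℕ) (S : Fin n → ℤ → Set) (f : (Fin n → ℤ) → ℤ) →
    OrderPreserving n S f →
    (Gs : Fin n → Game) →
    (∀ i → InI (Gs i)) →
    (∀ i → Valued (S i) (Gs i)) →
    InI (ext f Gs)
mainTheorem10 n S f mono Gs inI valued =
  𝓘⇒InI (Comparison.𝓘-ext S f mono (ℕ.n<1+n _) (𝓘Gs , valued))
  where
  𝓘Gs : ∀ i → 𝓘ₜ (Gs i)
  𝓘Gs i = 𝓘⇒𝓘ₜ (proj₂ (InI⇒𝓘 (inI i)))
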